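{- Let $k\ge 2$ and let $G$ be the vertex sum of graphs $H_1$ and $H_2$ over their common vertex $v$. If $H_1$ and $H_2$ are $k$-connected, then so is $G$.
   Context: Graphs may have loops and parallel edges. Vertex sum: let $H_1,H_2$ be graphs whose only common vertex is $v$, with a bijection $\psi$ between the edges of $H_1$ incident with $v$ and the edges of $H_2$ incident with $v$. The vertex sum of $H_1$ and $H_2$ over $v$ (with respect to $\psi$) is obtained from the disjoint union of $H_1$ and $H_2$ by deleting $v$ in both and adding an edge $v_1v_2$ for each pair $v_1\in V(H_1)$, $v_2\in V(H_2)$ such that $v_1v$ and $v_2v$ are mapped to one another by $\psi$. $k$-connectivity (for $k\ge2$): a graph with at least $k+1$ vertices is $k$-connected if deleting fewer than $k$ vertices never disconnects it, it has no loops, and, if $k>2$, it has no parallel edges. In addition, every graph with exactly two vertices, no loops and at least two parallel edges is 2-connected. No other graph with at most $k$ vertices is $k$-connected. -}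

module Defs where

open import Data.Nat using (ℕ; _≤_; _<_; _>_; suc)
open import Data.Fin using (Fin; _≟_)
open import Data.Fin.Subset using (Subset; ∣_∣; _∉_)
open import Data.Bool using (Bool; _∨_; if_then_else_; not)
open import Data.Unit using (⊤)
open import Data.Product using (Σ; _×_; _,_; proj₁; proj₂)
open import Data.Sum using (_⊎_; inj₁; inj₂)
open import Relation.Binary.PropositionalEquality using (_≡_; _≢_)
open import Relation.Nullary using (¬_; ⌊_⌋)
open import Data.Bool using (T)
open import Function.Bundles using (_↔_; Inverse)

-- A finite multigraph (loops and parallel edges allowed):
-- vertices Fin n, edges Fin m, each edge has two ends (an unordered pair,
-- stored in some arbitrary order; all notions below ignore the order).
record Graph : Set where
  field
    n    : ℕ
    m    : ℕ
    ends : Fin m → Fin n × Fin n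
open Graph public

SameEnds : {A : Set} → A × A → A × A → Set
SameEnds (a , b) (c , d) = (a ≡ c × b ≡ d) ⊎ (a ≡ d × b ≡ c)

-- edge e is incident with vertex x (a boolean, so "incident" is a proposition)
inc : (G : Graph) → Fin (m G) → Fin (n G) → Bool
inc G e x = ⌊ proj₁ (ends G e) ≟ x ⌋ ∨ ⌊ proj₂ (ends G e) ≟ x ⌋

IncEdges : (G : Graph) → Fin (n G) → Set
IncEdges G x = Σ (Fin (m G)) (λ e → T (inc G e x))

NonIncEdges : (G : Graph) → Fin (n G) → Set
NonIncEdges G x = Σ (Fin (m G)) (λ e → T (not (inc G e x)))

-- the other end of an edge e at vertex x (equals x for a loop at x)
other : (G : Graph) → Fin (m G) → Fin (n G) → Fin (n G)
other G e x = if ⌊ proj₁ (ends G e) ≟ x ⌋ then proj₂ (ends G e) else proj₁ (ends G e)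

Loop : (G : Graph) → Fin (m G) → Set
Loop G e = proj₁ (ends G e) ≡ proj₂ (ends G e)

NoLoops : Graph → Set
NoLoops G = ∀ e → ¬ Loop G e

Parallel : (G : Graph) → Fin (m G) → Fin (m G) → Set
Parallel G e f = e ≢ f × SameEnds (ends G e) (ends G f)

NoParallel : Graph → Set
NoParallel G = ∀ e f → ¬ Parallel G e f

data Reach (G : Graph) (P : Fin (n G) → Set) : Fin (n G) → Fin (n G) → Set where
  here : ∀ {x} → P x → Reach G P x x
  step : ∀ {x y z} (e : Fin (m G)) → SameEnds (ends G e) (x , y) →
         P x → Reach G P y z → Reach G P x z

ConnectedWithout : (G : Graph) → Subset (n G) → Set
ConnectedWithout G X = ∀ x y → x ∉ X → y ∉ X → Reach G (λ z → z ∉ X) x y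

KConnected : ℕ → Graph → Set
KConnected k G =
    (suc k ≤ n G
      × (∀ (X : Subset (n G)) → ∣ X ∣ < k → ConnectedWithout G X)
      × NoLoops G
      × (k > 2 → NoParallel G))
  ⊎ (k ≡ 2 × n G ≡ 2 × NoLoops G × Σ (Fin (m G)) (λ e → Σ (Fin (m G)) (λ f → Parallel G e f)))

-- (side conditions are boolean T-propositions so that they are proof-irrelevant)
-- vertex set of the vertex sum: V(H₁) - v₁ plus V(H₂) - v₂
SumVerts : (H₁ : Graph) (v₁ : Fin (n H₁)) (H₂ : Graph) (v₂ : Fin (n H₂)) → Set
SumVerts H₁ v₁ H₂ v₂ = Σ (Fin (n H₁)) (λ x → T (not ⌊ x ≟ v₁ ⌋)) ⊎ Σ (Fin (n H₂)) (λ x → T (not ⌊ x ≟ v₂ ⌋))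

forget : ∀ {H₁ v₁ H₂ v₂} → SumVerts H₁ v₁ H₂ v₂ → Fin (n H₁) ⊎ Fin (n H₂)
forget (inj₁ (x , _)) = inj₁ x
forget (inj₂ (x , _)) = inj₂ x

-- edge set of the vertex sum: edges of H₁ avoiding v, edges of H₂ avoiding v,
-- and one new edge for each pair (e, ψ e) of edges at v
SumEdges : (H₁ : Graph) (v₁ : Fin (n H₁)) (H₂ : Graph) (v₂ : Fin (n H₂)) → Set
SumEdges H₁ v₁ H₂ v₂ = NonIncEdges H₁ v₁ ⊎ NonIncEdges H₂ v₂ ⊎ IncEdges H₁ v₁

sumEnds : (H₁ : Graph) (v₁ : Fin (n H₁)) (H₂ : Graph) (v₂ : Fin (n H₂)) →
          (IncEdges H₁ v₁ ↔ IncEdges H₂ v₂) →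
          SumEdges H₁ v₁ H₂ v₂ → (Fin (n H₁) ⊎ Fin (n H₂)) × (Fin (n H₁) ⊎ Fin (n H₂))
sumEnds H₁ v₁ H₂ v₂ ψ (inj₁ (e , _)) = inj₁ (proj₁ (ends H₁ e)) , inj₁ (proj₂ (ends H₁ e))
sumEnds H₁ v₁ H₂ v₂ ψ (inj₂ (inj₁ (e , _))) = inj₂ (proj₁ (ends H₂ e)) , inj₂ (proj₂ (ends H₂ e))
sumEnds H₁ v₁ H₂ v₂ ψ (inj₂ (inj₂ (e , p))) =
  inj₁ (other H₁ e v₁) , inj₂ (other H₂ (proj₁ (Inverse.to ψ (e , p))) v₂)

-- G is (isomorphic to) the vertex sum of H₁ and H₂ over their common vertex v
-- (v₁ and v₂ are v as a vertex of H₁, resp. H₂) with respect to ψ.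
record IsVertexSum (G H₁ : Graph) (v₁ : Fin (n H₁)) (H₂ : Graph) (v₂ : Fin (n H₂))
                   (ψ : IncEdges H₁ v₁ ↔ IncEdges H₂ v₂) : Set where
  field
    vmap  : Fin (n G) ↔ SumVerts H₁ v₁ H₂ v₂
    emap  : Fin (m G) ↔ SumEdges H₁ v₁ H₂ v₂
    respects : ∀ (f : Fin (m G)) →
      SameEnds (forget {H₁} {v₁} {H₂} {v₂} (Inverse.to vmap (proj₁ (ends G f))) ,
                forget {H₁} {v₁} {H₂} {v₂} (Inverse.to vmap (proj₂ (ends G f))))
               (sumEnds H₁ v₁ H₂ v₂ ψ (Inverse.to emap f))

{-# OPTIONS --safe #-}
module Submission where

-- Fix X with |X| < k. If X misses the H₂-side, delete the trace of X from H₁: a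
-- walk in what is left of H₁ that passes through v is rerouted through H₂ - v,
-- which is connected, along the two new edges replacing the edges used at v.
-- Otherwise X meets both sides, so k ≥ 3 and H₁, H₂ have no parallel edges.
-- Each side stays connected after deleting v together with the trace of X, since
-- a vertex of X on the other side pays for v. The sides are joined by a new edge
-- avoiding X: call a neighbour u of v in H₁ blocked if u ∈ X or the new edge made
-- from vu ends in X. Without parallel edges the blocked vertices inject into X,
-- so they do not separate v from the rest of H₁, and the first step of a walk
-- away from v reaches an unblocked neighbour.

open import Defs
open import Data.Nat using (ℕ; suc; _≤_; _<_; _>_; _+_; z≤n; s≤s)
open import Data.Fin using (Fin; zero; suc; _≟_)
open import Function.Bundles using (_↔_; Inverse; Injection; Equivalence)

open import Data.Bool using (Bool; true; false; T; not)
open import Data.Bool.Properties using (T-≡; T-irrelevant)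
open import Data.Empty using (⊥-elim)
open import Data.Fin.Properties using (any?; all?; ¬∀⟶∃¬; injective⇒≤; suc-injective; 0≢1+n)
open import Data.Fin.Subset using (Subset; ⊤; ∣_∣; _∈_; _∉_; _∪_; _-_; ⁅_⁆; inside; outside)
open import Data.Fin.Subset.Properties
  using (_∈?_; x∈p⇒∣p-x∣<∣p∣; x∈p∧x≢y⇒x∈p-y; x∈p∪q⁺; x∈⁅x⁆; ∣⁅x⁆∣≡1; x≢y⇒x∉⁅y⁆; x∉⁅y⁆⇒x≢y; ∣⊤∣≡n; p⊆q⇒∣p∣≤∣q∣)
import Data.Nat.Properties as ℕ
open import Data.Product using (Σ; ∃; _×_; _,_; proj₁; proj₂)
open import Data.Sum using (_⊎_; inj₁; inj₂; swap)
open import Data.Sum.Properties using (inj₁-injective; inj₂-injective)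
open import Data.Unit using (tt)
open import Data.Vec using (_∷_; []; tabulate)
open import Data.Vec.Properties using (lookup∘tabulate; []=⇒lookup; lookup⇒[]=)
open import Function using (_∘_)
open import Function.Properties.Inverse using (↔-sym; ↔⇒↣)
open import Relation.Binary.PropositionalEquality
open import Relation.Nullary using (Dec; yes; no; ⌊_⌋)
open import Relation.Nullary.Decidable using (toWitness; fromWitness; map′; ¬?; _×-dec_; _⊎-dec_)
open import Relation.Unary using (Decidable)

-- Endpoint pairs and incidence

module _ {A : Set} where

  SameEnds-sym : {p q : A × A} → SameEnds p q → SameEnds q p
  SameEnds-sym (inj₁ (refl , refl)) = inj₁ (refl , refl)
  SameEnds-sym (inj₂ (refl , refl)) = inj₂ (refl , refl)

  SameEnds-trans : {p q r : A × A} → SameEnds p q → SameEnds q r → SameEnds p r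
  SameEnds-trans (inj₁ (refl , refl)) s = s
  SameEnds-trans (inj₂ (refl , refl)) (inj₁ (refl , refl)) = inj₂ (refl , refl)
  SameEnds-trans (inj₂ (refl , refl)) (inj₂ (refl , refl)) = inj₁ (refl , refl)

  SameEnds-swapʳ : {p : A × A} {x y : A} → SameEnds p (x , y) → SameEnds p (y , x)
  SameEnds-swapʳ (inj₁ (refl , refl)) = inj₂ (refl , refl)
  SameEnds-swapʳ (inj₂ (refl , refl)) = inj₁ (refl , refl)

  SameEnds-loop : {a b c d : A} → a ≡ b → SameEnds (a , b) (c , d) → c ≡ d
  SameEnds-loop refl (inj₁ (refl , refl)) = refl
  SameEnds-loop refl (inj₂ (refl , refl)) = refl

module _ {A B : Set} (f : A → B) {a b c d : A} where

  SameEnds-map : SameEnds (a , b) (c , d) → SameEnds (f a , f b) (f c , f d)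
  SameEnds-map (inj₁ (refl , refl)) = inj₁ (refl , refl)
  SameEnds-map (inj₂ (refl , refl)) = inj₂ (refl , refl)

  SameEnds-injective : (∀ {x y} → f x ≡ f y → x ≡ y) →
                       SameEnds (f a , f b) (f c , f d) → SameEnds (a , b) (c , d)
  SameEnds-injective inj (inj₁ (p , q)) = inj₁ (inj p , inj q)
  SameEnds-injective inj (inj₂ (p , q)) = inj₂ (inj p , inj q)

Σ-T-≡ : ∀ {A : Set} {B : A → Bool} {a a′ : Σ A (T ∘ B)} → proj₁ a ≡ proj₁ a′ → a ≡ a′
Σ-T-≡ {a = x , t} {.x , t′} refl = cong (x ,_) (T-irrelevant t t′)

EdgeBetween : (G : Graph) → Fin (n G) → Fin (n G) → Set
EdgeBetween G x y = Σ (Fin (m G)) λ e → SameEnds (ends G e) (x , y)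

far : (H : Graph) (v : Fin (n H)) → IncEdges H v → Fin (n H)
far H v (e , _) = other H e v

module _ (H : Graph) {e : Fin (m H)} {x y : Fin (n H)} where

  incident-start : SameEnds (ends H e) (x , y) → T (inc H e x)
  incident-start s with proj₁ (ends H e) ≟ x | proj₂ (ends H e) ≟ x | s
  ... | yes _ | _     | _            = tt
  ... | no _  | yes _ | _            = tt
  ... | no ¬p | no _  | inj₁ (p , _) = ¬p p
  ... | no _  | no ¬q | inj₂ (_ , q) = ¬q q

  other-start : SameEnds (ends H e) (x , y) → other H e x ≡ y
  other-start s with proj₁ (ends H e) ≟ x | s
  ... | yes _  | inj₁ (_ , q) = q
  ... | yes p  | inj₂ (q , r) = trans (trans r (sym p)) q
  ... | no ¬p  | inj₁ (p , _) = ⊥-elim (¬p p)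
  ... | no _   | inj₂ (p , _) = p

  not-incident : SameEnds (ends H e) (x , y) → ∀ {v} → x ≢ v → y ≢ v → T (not (inc H e v))
  not-incident s {v} x≢v y≢v with proj₁ (ends H e) ≟ v | proj₂ (ends H e) ≟ v | s
  ... | no _  | no _  | _            = tt
  ... | yes p | _     | inj₁ (q , _) = x≢v (trans (sym q) p)
  ... | yes p | _     | inj₂ (q , _) = y≢v (trans (sym q) p)
  ... | no _  | yes p | inj₁ (_ , q) = y≢v (trans (sym q) p)
  ... | no _  | yes p | inj₂ (_ , q) = x≢v (trans (sym q) p)

module _ (H : Graph) where

  edgeAt : ∀ {e v x} → SameEnds (ends H e) (v , x) → IncEdges H v
  edgeAt {e} s = e , incident-start H s

  far-edgeAt : ∀ {e v x} (s : SameEnds (ends H e) (v , x)) → far H v (edgeAt s) ≡ x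
  far-edgeAt = other-start H

  ends-far : ∀ {v} (a : IncEdges H v) → SameEnds (ends H (proj₁ a)) (v , far H v a)
  ends-far {v} (e , t) with proj₁ (ends H e) ≟ v | proj₂ (ends H e) ≟ v
  ... | yes p | _     = inj₁ (p , refl)
  ... | no _  | yes q = inj₂ (refl , q)

  joins⇒≢ : NoLoops H → ∀ {e x y} → SameEnds (ends H e) (x , y) → x ≢ y
  joins⇒≢ noLoops {e} (inj₁ (refl , refl)) x≡y = noLoops e x≡y
  joins⇒≢ noLoops {e} (inj₂ (refl , refl)) x≡y = noLoops e (sym x≡y)

  far≢ : NoLoops H → ∀ {v} (a : IncEdges H v) → far H v a ≢ v
  far≢ noLoops a eq = joins⇒≢ noLoops (ends-far a) (sym eq)

  NoParallel⇒≡ : NoParallel H → ∀ {e f} → SameEnds (ends H e) (ends H f) → e ≡ f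
  NoParallel⇒≡ noPar {e} {f} s with e ≟ f
  ... | yes e≡f = e≡f
  ... | no e≢f  = ⊥-elim (noPar e f (e≢f , s))

  far-injective : NoParallel H → ∀ {v} (a b : IncEdges H v) → far H v a ≡ far H v b → a ≡ b
  far-injective noPar a b eq = Σ-T-≡ (NoParallel⇒≡ noPar (SameEnds-trans (ends-far a)
    (subst (λ w → SameEnds (_ , w) (ends H (proj₁ b))) (sym eq) (SameEnds-sym (ends-far b)))))

-- Walks

module _ {G : Graph} {P : Fin (n G) → Set} where

  origin : ∀ {x y} → Reach G P x y → P x
  origin (here p)       = p
  origin (step _ _ p _) = p

  via : ∀ {x y z} → EdgeBetween G x y → P x → Reach G P y z → Reach G P x z
  via (e , s) = step e s

  _◅◅_ : ∀ {x y z} → Reach G P x y → Reach G P y z → Reach G P x z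
  here _       ◅◅ r′ = r′
  step e s p r ◅◅ r′ = step e s p (r ◅◅ r′)

  reverse : ∀ {x y} → Reach G P x y → Reach G P y x
  reverse (here p)       = here p
  reverse (step e s p r) = reverse r ◅◅ step e (SameEnds-swapʳ s) (origin r) (here p)

EdgeBetween-sym : ∀ {G x y} → EdgeBetween G x y → EdgeBetween G y x
EdgeBetween-sym (e , s) = e , SameEnds-swapʳ s

leave : ∀ {H P v y} → Reach H P v y → y ≢ v → Σ (IncEdges H v) λ a → P (far H v a)
leave (here _)               y≢v = ⊥-elim (y≢v refl)
leave {H} {P} (step _ s _ r) _   = edgeAt H s , subst P (sym (far-edgeAt H s)) (origin r)

Reach-map : ∀ {H G P Q} (f : Fin (n H) → Fin (n G)) →
  (∀ {x} → P x → Q (f x)) →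
  (∀ {e x y} → SameEnds (ends H e) (x , y) → P x → P y → EdgeBetween G (f x) (f y)) →
  ∀ {x y} → Reach H P x y → Reach G Q (f x) (f y)
Reach-map f f-P f-edge (here p)       = here (f-P p)
Reach-map f f-P f-edge (step e s p r) =
  via (f-edge s p (origin r)) (f-P p) (Reach-map f f-P f-edge r)

-- Counting subsets

module _ {a : ℕ} {P : Fin a → Set} where

  fromDec : Decidable P → Subset a
  fromDec P? = tabulate (λ x → ⌊ P? x ⌋)

  ∈-fromDec⁺ : (P? : Decidable P) → ∀ {x} → P x → x ∈ fromDec P?
  ∈-fromDec⁺ P? {x} px =
    lookup⇒[]= x _ (trans (lookup∘tabulate _ x) (Equivalence.to T-≡ (fromWitness {a? = P? x} px)))

  ∈-fromDec⁻ : (P? : Decidable P) → ∀ {x} → x ∈ fromDec P? → P x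
  ∈-fromDec⁻ P? {x} x∈ =
    toWitness {a? = P? x} (Equivalence.from T-≡ (trans (sym (lookup∘tabulate _ x)) ([]=⇒lookup x∈)))

∣fromDec∣≤ : ∀ {a b} {P : Fin a → Set} (P? : Decidable P) (X : Subset b)
  (w : ∀ {x} → P x → Fin b) → (∀ {x} (p : P x) → w p ∈ X) →
  (∀ {x y} (p : P x) (q : P y) → w p ≡ w q → x ≡ y) → ∣ fromDec P? ∣ ≤ ∣ X ∣
∣fromDec∣≤ {0}     P? X w w∈ w-inj = z≤n
∣fromDec∣≤ {suc a} {P = P} P? X w w∈ w-inj with P? zero
... | no _   = ∣fromDec∣≤ {P = λ x → P (suc x)} (λ x → P? (suc x)) X w w∈
                 (λ p q eq → suc-injective (w-inj p q eq))
... | yes p₀ = ℕ.≤-trans (s≤s rest) (x∈p⇒∣p-x∣<∣p∣ (w∈ p₀))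
  where
  rest : ∣ fromDec (λ x → P? (suc x)) ∣ ≤ ∣ X - w p₀ ∣
  rest = ∣fromDec∣≤ {P = λ x → P (suc x)} (λ x → P? (suc x)) (X - w p₀) w
           (λ q → x∈p∧x≢y⇒x∈p-y (w∈ q) (λ eq → 0≢1+n (w-inj p₀ q (sym eq))))
           (λ p q eq → suc-injective (w-inj p q eq))

Σ-T? : ∀ b {Q : T b → Set} → ((t : T b) → Dec (Q t)) → Dec (Σ (T b) Q)
Σ-T? true  Q? = map′ (tt ,_) proj₂ (Q? tt)
Σ-T? false _  = no λ { (() , _) }

IncEdges-any? : ∀ {H v} {Q : IncEdges H v → Set} → (∀ a → Dec (Q a)) → Dec (Σ (IncEdges H v) Q)
IncEdges-any? {H} {v} Q? = map′ (λ (e , t , q) → (e , t) , q) (λ ((e , t) , q) → e , t , q)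
  (any? λ e → Σ-T? (inc H e v) (λ t → Q? (e , t)))

∣p∪q∣≤∣p∣+∣q∣ : ∀ {a} (p q : Subset a) → ∣ p ∪ q ∣ ≤ ∣ p ∣ + ∣ q ∣
∣p∪q∣≤∣p∣+∣q∣ []            []            = z≤n
∣p∪q∣≤∣p∣+∣q∣ (inside ∷ p)  (inside ∷ q)  =
  s≤s (ℕ.≤-trans (∣p∪q∣≤∣p∣+∣q∣ p q) (ℕ.+-monoʳ-≤ ∣ p ∣ (ℕ.n≤1+n ∣ q ∣)))
∣p∪q∣≤∣p∣+∣q∣ (inside ∷ p)  (outside ∷ q) = s≤s (∣p∪q∣≤∣p∣+∣q∣ p q)
∣p∪q∣≤∣p∣+∣q∣ (outside ∷ p) (inside ∷ q)  =
  subst (suc ∣ p ∪ q ∣ ≤_) (sym (ℕ.+-suc ∣ p ∣ ∣ q ∣)) (s≤s (∣p∪q∣≤∣p∣+∣q∣ p q))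
∣p∪q∣≤∣p∣+∣q∣ (outside ∷ p) (outside ∷ q) = ∣p∪q∣≤∣p∣+∣q∣ p q

∣p∣<n⇒∃∉p : ∀ {a} (p : Subset a) → ∣ p ∣ < a → ∃ λ x → x ∉ p
∣p∣<n⇒∃∉p {a} p ∣p∣<a with all? (_∈? p)
... | yes all∈ = ⊥-elim (ℕ.<⇒≱ ∣p∣<a
                   (subst (_≤ ∣ p ∣) (∣⊤∣≡n a) (p⊆q⇒∣p∣≤∣q∣ {p = ⊤} (λ {x} _ → all∈ x))))
... | no ¬all∈ = ¬∀⟶∃¬ a (_∈ p) (_∈? p) ¬all∈

∉p∪⁅x⁆ : ∀ {a} {p : Subset a} {x y} → y ∉ p ∪ ⁅ x ⁆ → y ∉ p × y ≢ x
∉p∪⁅x⁆ y∉ = y∉ ∘ x∈p∪q⁺ ∘ inj₁ , λ { refl → y∉ (x∈p∪q⁺ (inj₂ (x∈⁅x⁆ _))) }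

2≤∣p∣ : ∀ {a} {p : Subset a} {x y} → x ∈ p → y ∈ p → x ≢ y → 2 ≤ ∣ p ∣
2≤∣p∣ x∈p y∈p x≢y =
  ℕ.≤-trans (s≤s (ℕ.≤-trans (s≤s z≤n) (x∈p⇒∣p-x∣<∣p∣ (x∈p∧x≢y⇒x∈p-y y∈p (x≢y ∘ sym)))))
            (x∈p⇒∣p-x∣<∣p∣ x∈p)

∃≢ : ∀ {a} → 2 ≤ a → (v : Fin a) → ∃ λ x → x ≢ v
∃≢ (s≤s (s≤s _)) zero    = suc zero , λ ()
∃≢ (s≤s (s≤s _)) (suc _) = zero , λ ()

Fin2-≢⇒≡ : ∀ {a} → a ≡ 2 → {x y v : Fin a} → x ≢ v → y ≢ v → x ≡ y
Fin2-≢⇒≡ refl {zero}     {zero}             _   _   = refl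
Fin2-≢⇒≡ refl {suc zero} {suc zero}         _   _   = refl
Fin2-≢⇒≡ refl {zero}     {suc zero} {zero}  x≢v _   = ⊥-elim (x≢v refl)
Fin2-≢⇒≡ refl {zero}     {suc zero} {suc zero} _   y≢v = ⊥-elim (y≢v refl)
Fin2-≢⇒≡ refl {suc zero} {zero}     {zero}  _   y≢v = ⊥-elim (y≢v refl)
Fin2-≢⇒≡ refl {suc zero} {zero}     {suc zero} x≢v _   = ⊥-elim (x≢v refl)

Fin2-SameEnds : ∀ {a} → a ≡ 2 → {x y x′ y′ : Fin a} → x ≢ y → x′ ≢ y′ → SameEnds (x , y) (x′ , y′)
Fin2-SameEnds a≡2 {x} {y} {x′} {y′} x≢y x′≢y′ with x ≟ x′
... | yes refl = inj₁ (refl , Fin2-≢⇒≡ a≡2 (x≢y ∘ sym) (x′≢y′ ∘ sym))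
... | no x≢x′  = inj₂ (Fin2-≢⇒≡ a≡2 x≢x′ (x′≢y′ ∘ sym) , Fin2-≢⇒≡ a≡2 (x≢y ∘ sym) (x≢x′ ∘ sym))

module _ {k : ℕ} {H : Graph} where

  KConnected⇒NoLoops : KConnected k H → NoLoops H
  KConnected⇒NoLoops (inj₁ (_ , _ , noLoops , _)) = noLoops
  KConnected⇒NoLoops (inj₂ (_ , _ , noLoops , _)) = noLoops

  KConnected⇒NoParallel : k > 2 → KConnected k H → NoParallel H
  KConnected⇒NoParallel k>2 (inj₁ (_ , _ , _ , noPar)) = noPar k>2
  KConnected⇒NoParallel k>2 (inj₂ (refl , _))         = ⊥-elim (ℕ.<-irrefl refl k>2)

  KConnected⇒k<n : k > 2 → KConnected k H → k < n H
  KConnected⇒k<n k>2 (inj₁ (k<n , _)) = k<n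
  KConnected⇒k<n k>2 (inj₂ (refl , _)) = ⊥-elim (ℕ.<-irrefl refl k>2)

  KConnected⇒2≤n : 2 ≤ k → KConnected k H → 2 ≤ n H
  KConnected⇒2≤n 2≤k (inj₁ (k<n , _))      = ℕ.≤-trans 2≤k (ℕ.<⇒≤ k<n)
  KConnected⇒2≤n 2≤k (inj₂ (_ , n≡2 , _)) = ℕ.≤-reflexive (sym n≡2)

  KConnected⇒ConnectedWithout : KConnected k H → ∀ X → ∣ X ∣ < k → ConnectedWithout H X
  KConnected⇒ConnectedWithout (inj₁ (_ , connected , _)) = connected
  KConnected⇒ConnectedWithout (inj₂ (_ , n≡2 , noLoops , e , _)) X _ x y x∉X y∉X with x ≟ y
  ... | yes refl = here x∉X
  ... | no x≢y   = step e (Fin2-SameEnds n≡2 (noLoops e) x≢y) x∉X (here y∉X)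

-- Vertex sums

record SumView (G H₁ : Graph) (v₁ : Fin (n H₁)) (H₂ : Graph) (v₂ : Fin (n H₂)) : Set where
  field
    noLoops₁     : NoLoops H₁
    noLoops₂     : NoLoops H₂
    ι₁           : Fin (n H₁) → Fin (n G)
    ι₂           : Fin (n H₂) → Fin (n G)
    ι₁-injective : ∀ {x y} → x ≢ v₁ → y ≢ v₁ → ι₁ x ≡ ι₁ y → x ≡ y
    ι₂-injective : ∀ {x y} → x ≢ v₂ → y ≢ v₂ → ι₂ x ≡ ι₂ y → x ≡ y
    ι₁≢ι₂        : ∀ {x y} → x ≢ v₁ → y ≢ v₂ → ι₁ x ≢ ι₂ y
    cover        : ∀ g → (∃ λ x → x ≢ v₁ × ι₁ x ≡ g) ⊎ (∃ λ y → y ≢ v₂ × ι₂ y ≡ g)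
    edge₁        : ∀ {e x y} → SameEnds (ends H₁ e) (x , y) → x ≢ v₁ → y ≢ v₁ → EdgeBetween G (ι₁ x) (ι₁ y)
    edge₂        : ∀ {e x y} → SameEnds (ends H₂ e) (x , y) → x ≢ v₂ → y ≢ v₂ → EdgeBetween G (ι₂ x) (ι₂ y)
    ψ            : IncEdges H₁ v₁ ↔ IncEdges H₂ v₂
    cross        : ∀ a → EdgeBetween G (ι₁ (far H₁ v₁ a)) (ι₂ (far H₂ v₂ (Inverse.to ψ a)))

  partner : IncEdges H₁ v₁ → Fin (n H₂)
  partner a = far H₂ v₂ (Inverse.to ψ a)

  partner≢ : ∀ a → partner a ≢ v₂
  partner≢ a = far≢ H₂ noLoops₂ (Inverse.to ψ a)

  crossAt : ∀ {e x} (s : SameEnds (ends H₁ e) (v₁ , x)) → EdgeBetween G (ι₁ x) (ι₂ (partner (edgeAt H₁ s)))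
  crossAt s = subst (λ w → EdgeBetween G (ι₁ w) (ι₂ (partner (edgeAt H₁ s))))
                    (far-edgeAt H₁ s) (cross (edgeAt H₁ s))

flip : ∀ {G H₁ v₁ H₂ v₂} → SumView G H₁ v₁ H₂ v₂ → SumView G H₂ v₂ H₁ v₁
flip {G} {H₁} {v₁} {H₂} {v₂} V = record
  { noLoops₁ = noLoops₂ ; noLoops₂ = noLoops₁
  ; ι₁ = ι₂ ; ι₂ = ι₁ ; ι₁-injective = ι₂-injective ; ι₂-injective = ι₁-injective
  ; ι₁≢ι₂ = λ x≢v₂ y≢v₁ eq → ι₁≢ι₂ y≢v₁ x≢v₂ (sym eq)
  ; cover = λ g → swap (cover g)
  ; edge₁ = edge₂ ; edge₂ = edge₁
  ; ψ = ↔-sym ψ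
  ; cross = λ b → let (f , s) = cross (from b) in
      f , SameEnds-swapʳ (subst (λ b′ → SameEnds (ends G f) (_ , ι₂ (far H₂ v₂ b′))) (strictlyInverseˡ b) s)
  }
  where
  open SumView V
  open Inverse ψ using (from; strictlyInverseˡ)

module _ {G H₁ v₁ H₂ v₂} (V : SumView G H₁ v₁ H₂ v₂) where
  open SumView V

  n₁≤n : ∀ {y₀} → y₀ ≢ v₂ → n H₁ ≤ n G
  n₁≤n {y₀} y₀≢v₂ = injective⇒≤ {f = ι₁′} ι₁′-injective
    where
    ι₁′ : Fin (n H₁) → Fin (n G)
    ι₁′ x with x ≟ v₁
    ... | yes _ = ι₂ y₀
    ... | no _  = ι₁ x
    ι₁′-injective : ∀ {x y} → ι₁′ x ≡ ι₁′ y → x ≡ y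
    ι₁′-injective {x} {y} eq with x ≟ v₁ | y ≟ v₁
    ... | yes x≡v₁ | yes y≡v₁ = trans x≡v₁ (sym y≡v₁)
    ... | yes _    | no y≢v₁  = ⊥-elim (ι₁≢ι₂ y≢v₁ y₀≢v₂ (sym eq))
    ... | no x≢v₁  | yes _    = ⊥-elim (ι₁≢ι₂ x≢v₁ y₀≢v₂ eq)
    ... | no x≢v₁  | no y≢v₁  = ι₁-injective x≢v₁ y≢v₁ eq

  n≤2 : n H₁ ≡ 2 → n H₂ ≡ 2 → n G ≤ 2
  n≤2 n₁≡2 n₂≡2 = injective⇒≤ {f = side} side-injective
    where
    side : Fin (n G) → Fin 2
    side g with cover g
    ... | inj₁ _ = zero
    ... | inj₂ _ = suc zero
    side-injective : ∀ {g g′} → side g ≡ side g′ → g ≡ g′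
    side-injective {g} {g′} eq with cover g | cover g′
    ... | inj₁ (x , x≢v₁ , refl) | inj₁ (y , y≢v₁ , refl) = cong ι₁ (Fin2-≢⇒≡ n₁≡2 x≢v₁ y≢v₁)
    ... | inj₂ (x , x≢v₂ , refl) | inj₂ (y , y≢v₂ , refl) = cong ι₂ (Fin2-≢⇒≡ n₂≡2 x≢v₂ y≢v₂)

≢⇒T-not : ∀ {a} {x v : Fin a} → x ≢ v → T (not ⌊ x ≟ v ⌋)
≢⇒T-not {x = x} {v} x≢v with x ≟ v
... | yes x≡v = x≢v x≡v
... | no _    = tt

T-not⇒≢ : ∀ {a} {x v : Fin a} → T (not ⌊ x ≟ v ⌋) → x ≢ v
T-not⇒≢ {x = x} {v} t with x ≟ v
... | no x≢v = x≢v

module VertexSum {G H₁ : Graph} {v₁ : Fin (n H₁)} {H₂ : Graph} {v₂ : Fin (n H₂)}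
                 {ψ : IncEdges H₁ v₁ ↔ IncEdges H₂ v₂} (sum : IsVertexSum G H₁ v₁ H₂ v₂ ψ) where
  open IsVertexSum sum
  private
    module VM = Inverse vmap
    module EM = Inverse emap

  place : Fin (n G) → Fin (n H₁) ⊎ Fin (n H₂)
  place g = forget {H₁} {v₁} {H₂} {v₂} (VM.to g)

  forget-injective : ∀ {a b : SumVerts H₁ v₁ H₂ v₂} →
    forget {H₁} {v₁} {H₂} {v₂} a ≡ forget {H₁} {v₁} {H₂} {v₂} b → a ≡ b
  forget-injective {inj₁ _} {inj₁ _} eq = cong inj₁ (Σ-T-≡ (inj₁-injective eq))
  forget-injective {inj₂ _} {inj₂ _} eq = cong inj₂ (Σ-T-≡ (inj₂-injective eq))

  place-injective : ∀ {g g′} → place g ≡ place g′ → g ≡ g′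
  place-injective = Injection.injective (↔⇒↣ vmap) ∘ forget-injective

  endsOf : SumEdges H₁ v₁ H₂ v₂ → (Fin (n H₁) ⊎ Fin (n H₂)) × (Fin (n H₁) ⊎ Fin (n H₂))
  endsOf = sumEnds H₁ v₁ H₂ v₂ ψ

  place-ends-from : ∀ s → SameEnds (place (proj₁ (ends G (EM.from s))) , place (proj₂ (ends G (EM.from s))))
                                   (endsOf s)
  place-ends-from s = subst (λ s′ → SameEnds _ (endsOf s′)) (EM.strictlyInverseˡ s) (respects (EM.from s))

  sumEdge : ∀ s {x y} → SameEnds (endsOf s) (place x , place y) → EdgeBetween G x y
  sumEdge s ends≈ =
    EM.from s , SameEnds-injective place place-injective (SameEnds-trans (place-ends-from s) ends≈)

  someVertex : ∀ {y} → y ≢ v₂ → Fin (n G)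
  someVertex y≢v₂ = VM.from (inj₂ (_ , ≢⇒T-not y≢v₂))

  -- v₁ and v₂ are not vertices of G; ι₁ and ι₂ send them to an arbitrary vertex g₀.
  module _ (g₀ : Fin (n G)) where

    ι₁ : Fin (n H₁) → Fin (n G)
    ι₁ x with x ≟ v₁
    ... | yes _   = g₀
    ... | no x≢v₁ = VM.from (inj₁ (x , ≢⇒T-not x≢v₁))

    ι₂ : Fin (n H₂) → Fin (n G)
    ι₂ y with y ≟ v₂
    ... | yes _   = g₀
    ... | no y≢v₂ = VM.from (inj₂ (y , ≢⇒T-not y≢v₂))

    place-ι₁ : ∀ {x} → x ≢ v₁ → place (ι₁ x) ≡ inj₁ x
    place-ι₁ {x} x≢v₁ with x ≟ v₁
    ... | yes x≡v₁ = ⊥-elim (x≢v₁ x≡v₁)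
    ... | no x≢v₁′ = cong forget (VM.strictlyInverseˡ (inj₁ (x , ≢⇒T-not x≢v₁′)))

    place-ι₂ : ∀ {y} → y ≢ v₂ → place (ι₂ y) ≡ inj₂ y
    place-ι₂ {y} y≢v₂ with y ≟ v₂
    ... | yes y≡v₂ = ⊥-elim (y≢v₂ y≡v₂)
    ... | no y≢v₂′ = cong forget (VM.strictlyInverseˡ (inj₂ (y , ≢⇒T-not y≢v₂′)))

    cover : ∀ g → (∃ λ x → x ≢ v₁ × ι₁ x ≡ g) ⊎ (∃ λ y → y ≢ v₂ × ι₂ y ≡ g)
    cover g with VM.to g in eq
    ... | inj₁ (x , t) =
      inj₁ (x , T-not⇒≢ t , place-injective (trans (place-ι₁ (T-not⇒≢ t)) (sym (cong forget eq))))
    ... | inj₂ (y , t) =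
      inj₂ (y , T-not⇒≢ t , place-injective (trans (place-ι₂ (T-not⇒≢ t)) (sym (cong forget eq))))

    view : NoLoops H₁ → NoLoops H₂ → SumView G H₁ v₁ H₂ v₂
    view noLoops₁ noLoops₂ = record
      { noLoops₁ = noLoops₁ ; noLoops₂ = noLoops₂
      ; ι₁ = ι₁ ; ι₂ = ι₂
      ; ι₁-injective = λ x≢v₁ y≢v₁ → inj₁-injective ∘ via-place (place-ι₁ x≢v₁) (place-ι₁ y≢v₁)
      ; ι₂-injective = λ x≢v₂ y≢v₂ → inj₂-injective ∘ via-place (place-ι₂ x≢v₂) (place-ι₂ y≢v₂)
      ; ι₁≢ι₂ = λ x≢v₁ y≢v₂ → inj₁≢inj₂ ∘ via-place (place-ι₁ x≢v₁) (place-ι₂ y≢v₂)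
      ; cover = cover
      ; edge₁ = λ {e} s x≢v₁ y≢v₁ → sumEdge (inj₁ (e , not-incident H₁ s x≢v₁ y≢v₁))
          (subst₂ (λ a b → SameEnds _ (a , b)) (sym (place-ι₁ x≢v₁)) (sym (place-ι₁ y≢v₁))
                  (SameEnds-map inj₁ s))
      ; edge₂ = λ {e} s x≢v₂ y≢v₂ → sumEdge (inj₂ (inj₁ (e , not-incident H₂ s x≢v₂ y≢v₂)))
          (subst₂ (λ a b → SameEnds _ (a , b)) (sym (place-ι₂ x≢v₂)) (sym (place-ι₂ y≢v₂))
                  (SameEnds-map inj₂ s))
      ; ψ = ψ
      ; cross = λ a → sumEdge (inj₂ (inj₂ a))
          (subst₂ (λ a b → SameEnds _ (a , b)) (sym (place-ι₁ (far≢ H₁ noLoops₁ a)))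
                  (sym (place-ι₂ (far≢ H₂ noLoops₂ (Inverse.to ψ a)))) (inj₁ (refl , refl)))
      }
      where
      via-place : ∀ {g g′ u u′} → place g ≡ u → place g′ ≡ u′ → g ≡ g′ → u ≡ u′
      via-place p q refl = trans (sym p) q
      inj₁≢inj₂ : ∀ {A B : Set} {a : A} {b : B} → inj₁ a ≢ inj₂ b
      inj₁≢inj₂ ()

  sumEnds-injective : NoParallel H₁ → NoParallel H₂ → ∀ s s′ → SameEnds (endsOf s) (endsOf s′) → s ≡ s′
  sumEnds-injective np₁ _ (inj₁ _) (inj₁ _) q =
    cong inj₁ (Σ-T-≡ (NoParallel⇒≡ H₁ np₁ (SameEnds-injective inj₁ inj₁-injective q)))
  sumEnds-injective _ np₂ (inj₂ (inj₁ _)) (inj₂ (inj₁ _)) q =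
    cong (inj₂ ∘ inj₁) (Σ-T-≡ (NoParallel⇒≡ H₂ np₂ (SameEnds-injective inj₂ inj₂-injective q)))
  sumEnds-injective np₁ _ (inj₂ (inj₂ a)) (inj₂ (inj₂ b)) (inj₁ (far≡ , _)) =
    cong (inj₂ ∘ inj₂) (far-injective H₁ np₁ a b (inj₁-injective far≡))
  sumEnds-injective _ _ (inj₂ (inj₂ _)) (inj₂ (inj₂ _)) (inj₂ (() , _))
  sumEnds-injective _ _ (inj₁ _) (inj₂ (inj₁ _)) (inj₁ (() , _))
  sumEnds-injective _ _ (inj₁ _) (inj₂ (inj₁ _)) (inj₂ (() , _))
  sumEnds-injective _ _ (inj₁ _) (inj₂ (inj₂ _)) (inj₁ (_ , ()))
  sumEnds-injective _ _ (inj₁ _) (inj₂ (inj₂ _)) (inj₂ (() , _))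
  sumEnds-injective _ _ (inj₂ (inj₁ _)) (inj₁ _) (inj₁ (() , _))
  sumEnds-injective _ _ (inj₂ (inj₁ _)) (inj₁ _) (inj₂ (() , _))
  sumEnds-injective _ _ (inj₂ (inj₁ _)) (inj₂ (inj₂ _)) (inj₁ (() , _))
  sumEnds-injective _ _ (inj₂ (inj₁ _)) (inj₂ (inj₂ _)) (inj₂ (_ , ()))
  sumEnds-injective _ _ (inj₂ (inj₂ _)) (inj₁ _) (inj₁ (_ , ()))
  sumEnds-injective _ _ (inj₂ (inj₂ _)) (inj₁ _) (inj₂ (_ , ()))
  sumEnds-injective _ _ (inj₂ (inj₂ _)) (inj₂ (inj₁ _)) (inj₁ (() , _))
  sumEnds-injective _ _ (inj₂ (inj₂ _)) (inj₂ (inj₁ _)) (inj₂ (() , _))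

  noParallel : NoParallel H₁ → NoParallel H₂ → NoParallel G
  noParallel np₁ np₂ f f′ (f≢f′ , s) = f≢f′ (Injection.injective (↔⇒↣ emap)
    (sumEnds-injective np₁ np₂ _ _ (SameEnds-trans (SameEnds-sym (respects f))
      (SameEnds-trans (SameEnds-map place s) (respects f′)))))

  noLoops : NoLoops H₁ → NoLoops H₂ → NoLoops G
  noLoops nl₁ nl₂ f loop with EM.to f | respects f
  ... | inj₁ (e , _)        | s = nl₁ e (inj₁-injective (SameEnds-loop (cong place loop) s))
  ... | inj₂ (inj₁ (e , _)) | s = nl₂ e (inj₂-injective (SameEnds-loop (cong place loop) s))
  ... | inj₂ (inj₂ _)       | s with SameEnds-loop (cong place loop) s
  ...   | ()

  parallel-cross : n H₁ ≡ 2 → n H₂ ≡ 2 → NoLoops H₁ → NoLoops H₂ →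
    ∀ {e f} → Parallel H₁ e f → ∃ λ e′ → ∃ λ f′ → Parallel G e′ f′
  parallel-cross n₁≡2 n₂≡2 nl₁ nl₂ {e} {f} (e≢f , _) =
    EM.from (new a) , EM.from (new b) , e′≢f′ ,
    SameEnds-injective place place-injective
      (SameEnds-trans (place-ends-from (new a))
        (SameEnds-trans
          (subst₂ (λ x y → SameEnds (endsOf (new a)) (inj₁ x , inj₂ y)) far≡ partner≡ (inj₁ (refl , refl)))
          (SameEnds-sym (place-ends-from (new b)))))
    where
    new : IncEdges H₁ v₁ → SumEdges H₁ v₁ H₂ v₂
    new a = inj₂ (inj₂ a)
    x₀ : ∃ λ x → x ≢ v₁
    x₀ = ∃≢ (ℕ.≤-reflexive (sym n₁≡2)) v₁
    at-v₁ : Fin (m H₁) → IncEdges H₁ v₁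
    at-v₁ e = e , incident-start H₁ (Fin2-SameEnds n₁≡2 (nl₁ e) (proj₂ x₀ ∘ sym))
    a b : IncEdges H₁ v₁
    a = at-v₁ e
    b = at-v₁ f
    far≡ : far H₁ v₁ a ≡ far H₁ v₁ b
    far≡ = Fin2-≢⇒≡ n₁≡2 (far≢ H₁ nl₁ a) (far≢ H₁ nl₁ b)
    partner≡ : far H₂ v₂ (Inverse.to ψ a) ≡ far H₂ v₂ (Inverse.to ψ b)
    partner≡ = Fin2-≢⇒≡ n₂≡2 (far≢ H₂ nl₂ (Inverse.to ψ a)) (far≢ H₂ nl₂ (Inverse.to ψ b))
    e′≢f′ : EM.from (new a) ≢ EM.from (new b)
    e′≢f′ eq with Injection.injective (↔⇒↣ (↔-sym emap)) eq
    ... | refl = e≢f refl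

-- Connectivity of a vertex sum

SideConnected : ∀ {G H₁ v₁ H₂ v₂} → SumView G H₁ v₁ H₂ v₂ → Subset (n G) → Set
SideConnected {G} {v₁ = v₁} V X =
  ∀ {a b} → a ≢ v₁ → b ≢ v₁ → ι₁ a ∉ X → ι₁ b ∉ X → Reach G (_∉ X) (ι₁ a) (ι₁ b)
  where open SumView V

module _ {G H₁ v₁ H₂ v₂} (V : SumView G H₁ v₁ H₂ v₂) (X : Subset (n G)) where
  open SumView V

  record Bridge : Set where
    field
      {u}  : Fin (n H₁)
      {p}  : Fin (n H₂)
      u≢v₁ : u ≢ v₁
      p≢v₂ : p ≢ v₂
      u∉X  : ι₁ u ∉ X
      p∉X  : ι₂ p ∉ X
      edge : EdgeBetween G (ι₁ u) (ι₂ p)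

  bridge : (a : IncEdges H₁ v₁) → ι₁ (far H₁ v₁ a) ∉ X → ι₂ (partner a) ∉ X → Bridge
  bridge a u∉X p∉X = record
    { u≢v₁ = far≢ H₁ noLoops₁ a ; p≢v₂ = partner≢ a
    ; u∉X = u∉X ; p∉X = p∉X ; edge = cross a }

  Preimage₁ : Fin (n H₁) → Set
  Preimage₁ z = z ≢ v₁ × ι₁ z ∈ X

  preimage₁? : Decidable Preimage₁
  preimage₁? z = ¬? (z ≟ v₁) ×-dec (ι₁ z ∈? X)

  module _ (walk₁ : SideConnected V X) (walk₂ : SideConnected (flip V) X)
           (bridgeFrom : ∀ {a} → a ≢ v₁ → ι₁ a ∉ X → Bridge) where

    walk-across : ∀ {a q} → a ≢ v₁ → q ≢ v₂ → ι₁ a ∉ X → ι₂ q ∉ X → Reach G (_∉ X) (ι₁ a) (ι₂ q)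
    walk-across a≢v₁ q≢v₂ a∉X q∉X =
      walk₁ a≢v₁ u≢v₁ a∉X u∉X ◅◅ via edge u∉X (walk₂ p≢v₂ q≢v₂ p∉X q∉X)
      where open Bridge (bridgeFrom a≢v₁ a∉X)

    connected-via-bridges : ConnectedWithout G X
    connected-via-bridges x y x∉X y∉X with cover x | cover y
    ... | inj₁ (a , a≢v₁ , refl) | inj₁ (b , b≢v₁ , refl) = walk₁ a≢v₁ b≢v₁ x∉X y∉X
    ... | inj₁ (a , a≢v₁ , refl) | inj₂ (q , q≢v₂ , refl) = walk-across a≢v₁ q≢v₂ x∉X y∉X
    ... | inj₂ (p , p≢v₂ , refl) | inj₁ (b , b≢v₁ , refl) = reverse (walk-across b≢v₁ p≢v₂ y∉X x∉X)
    ... | inj₂ (p , p≢v₂ , refl) | inj₂ (q , q≢v₂ , refl) = walk₂ p≢v₂ q≢v₂ x∉X y∉X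

module _ {G H₁ v₁ H₂ v₂} (V : SumView G H₁ v₁ H₂ v₂) where
  open SumView V

  module _ {k} (2≤k : 2 ≤ k) (K₁ : KConnected k H₁) (K₂ : KConnected k H₂)
           (X : Subset (n G)) (∣X∣<k : ∣ X ∣ < k) (side₂∉X : ∀ {y} → y ≢ v₂ → ι₂ y ∉ X) where

    X₁ : Subset (n H₁)
    X₁ = fromDec (preimage₁? V X)

    ∣X₁∣<k : ∣ X₁ ∣ < k
    ∣X₁∣<k = ℕ.≤-<-trans
      (∣fromDec∣≤ (preimage₁? V X) X (λ {z} _ → ι₁ z) proj₂ (λ p q → ι₁-injective (proj₁ p) (proj₁ q)))
      ∣X∣<k

    ∉X₁⁺ : ∀ {z} → ι₁ z ∉ X → z ∉ X₁
    ∉X₁⁺ ι₁z∉X z∈X₁ = ι₁z∉X (proj₂ (∈-fromDec⁻ (preimage₁? V X) z∈X₁))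

    ∉X₁⁻ : ∀ {z} → z ≢ v₁ → z ∉ X₁ → ι₁ z ∉ X
    ∉X₁⁻ z≢v₁ z∉X₁ ι₁z∈X = z∉X₁ (∈-fromDec⁺ (preimage₁? V X) (z≢v₁ , ι₁z∈X))

    v₁∉X₁ : v₁ ∉ X₁
    v₁∉X₁ v₁∈X₁ = proj₁ (∈-fromDec⁻ (preimage₁? V X) v₁∈X₁) refl

    walk₂ : SideConnected (flip V) X
    walk₂ {p} {q} p≢v₂ q≢v₂ _ _ =
      Reach-map ι₂ (side₂∉X ∘ x∉⁅y⁆⇒x≢y) (λ s x∉ y∉ → edge₂ s (x∉⁅y⁆⇒x≢y x∉) (x∉⁅y⁆⇒x≢y y∉))
        (KConnected⇒ConnectedWithout K₂ ⁅ v₂ ⁆ (subst (_< k) (sym (∣⁅x⁆∣≡1 v₂)) 2≤k)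
          p q (x≢y⇒x∉⁅y⁆ p≢v₂) (x≢y⇒x∉⁅y⁆ q≢v₂))

    -- A visit to v₁ is replaced by a detour through the second side, which X does not meet.
    reroute : ∀ {a b} → Reach H₁ (_∉ X₁) a b → a ≢ v₁ → b ≢ v₁ → Reach G (_∉ X) (ι₁ a) (ι₁ b)
    reroute (here a∉X₁) a≢v₁ _ = here (∉X₁⁻ a≢v₁ a∉X₁)
    reroute (step {y = y} e s a∉X₁ r) a≢v₁ b≢v₁ with y ≟ v₁
    ... | no y≢v₁ = via (edge₁ s a≢v₁ y≢v₁) (∉X₁⁻ a≢v₁ a∉X₁) (reroute r y≢v₁ b≢v₁)
    ... | yes refl with r
    ...   | here _ = ⊥-elim (b≢v₁ refl)
    ...   | step {y = z} g s′ _ r′ =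
            via (crossAt (SameEnds-swapʳ s)) (∉X₁⁻ a≢v₁ a∉X₁)
              (walk₂ (partner≢ _) (partner≢ _) (side₂∉X (partner≢ _)) (side₂∉X (partner≢ _))
               ◅◅ via (EdgeBetween-sym (crossAt s′)) (side₂∉X (partner≢ _)) (reroute r′ z≢v₁ b≢v₁))
      where
      z≢v₁ : z ≢ v₁
      z≢v₁ = joins⇒≢ H₁ noLoops₁ s′ ∘ sym

    walk₁ : SideConnected V X
    walk₁ {a} {b} a≢v₁ b≢v₁ a∉X b∉X =
      reroute (KConnected⇒ConnectedWithout K₁ X₁ ∣X₁∣<k a b (∉X₁⁺ a∉X) (∉X₁⁺ b∉X)) a≢v₁ b≢v₁

    bridgeFrom : ∀ {a} → a ≢ v₁ → ι₁ a ∉ X → Bridge V X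
    bridgeFrom {a} a≢v₁ a∉X =
      let (e , far∉X₁) = leave (KConnected⇒ConnectedWithout K₁ X₁ ∣X₁∣<k v₁ a v₁∉X₁ (∉X₁⁺ a∉X)) a≢v₁
      in bridge V X e (∉X₁⁻ (far≢ H₁ noLoops₁ e) far∉X₁) (side₂∉X (partner≢ e))

    connected-avoiding-side₂ : ConnectedWithout G X
    connected-avoiding-side₂ = connected-via-bridges V X walk₁ walk₂ bridgeFrom

  module _ {k} (K₁ : KConnected k H₁) (X : Subset (n G)) (∣X∣<k : ∣ X ∣ < k)
           {w₂} (w₂≢v₂ : w₂ ≢ v₂) (ι₂w₂∈X : ι₂ w₂ ∈ X) where

    -- v₁ can be deleted as well, since its slot in X is taken by ι₂ w₂.
    walk₁-meeting-side₂ : SideConnected V X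
    walk₁-meeting-side₂ {a} {b} a≢v₁ b≢v₁ a∉X b∉X =
      Reach-map ι₁ (λ z∉S ι₁z∈X → z∉S (∈-fromDec⁺ S? (inj₂ (≢v₁ z∉S , ι₁z∈X))))
        (λ s x∉S y∉S → edge₁ s (≢v₁ x∉S) (≢v₁ y∉S))
        (KConnected⇒ConnectedWithout K₁ (fromDec S?) ∣S∣<k a b (∉S a≢v₁ a∉X) (∉S b≢v₁ b∉X))
      where
      S? : Decidable (λ z → z ≡ v₁ ⊎ Preimage₁ V X z)
      S? z = (z ≟ v₁) ⊎-dec preimage₁? V X z
      witness : ∀ {z} → z ≡ v₁ ⊎ Preimage₁ V X z → Fin (n G)
      witness {z} (inj₁ _) = ι₂ w₂
      witness {z} (inj₂ _) = ι₁ z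
      witness-injective : ∀ {z z′} (p : z ≡ v₁ ⊎ Preimage₁ V X z) (q : z′ ≡ v₁ ⊎ Preimage₁ V X z′) →
                          witness p ≡ witness q → z ≡ z′
      witness-injective (inj₁ z≡v₁)        (inj₁ z′≡v₁)        _  = trans z≡v₁ (sym z′≡v₁)
      witness-injective (inj₁ _)           (inj₂ (z′≢v₁ , _)) eq = ⊥-elim (ι₁≢ι₂ z′≢v₁ w₂≢v₂ (sym eq))
      witness-injective (inj₂ (z≢v₁ , _))  (inj₁ _)           eq = ⊥-elim (ι₁≢ι₂ z≢v₁ w₂≢v₂ eq)
      witness-injective (inj₂ (z≢v₁ , _))  (inj₂ (z′≢v₁ , _)) eq = ι₁-injective z≢v₁ z′≢v₁ eq
      ∣S∣<k : ∣ fromDec S? ∣ < k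
      ∣S∣<k = ℕ.≤-<-trans (∣fromDec∣≤ S? X witness
        (λ { (inj₁ _) → ι₂w₂∈X ; (inj₂ (_ , ι₁z∈X)) → ι₁z∈X }) witness-injective) ∣X∣<k
      ≢v₁ : ∀ {z} → z ∉ fromDec S? → z ≢ v₁
      ≢v₁ z∉S z≡v₁ = z∉S (∈-fromDec⁺ S? (inj₁ z≡v₁))
      ∉S : ∀ {z} → z ≢ v₁ → ι₁ z ∉ X → z ∉ fromDec S?
      ∉S z≢v₁ ι₁z∉X z∈S with ∈-fromDec⁻ S? z∈S
      ... | inj₁ z≡v₁        = z≢v₁ z≡v₁
      ... | inj₂ (_ , ι₁z∈X) = ι₁z∉X ι₁z∈X

  module _ {k} (k>2 : k > 2) (K₁ : KConnected k H₁) (K₂ : KConnected k H₂)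
           (X : Subset (n G)) (∣X∣<k : ∣ X ∣ < k) where

    -- A blocked z cannot be the H₁-end of a bridge: ι₁ z ∈ X, or the new edge made from v₁z ends in X.
    Blocked : Fin (n H₁) → Set
    Blocked z = Preimage₁ V X z ⊎ Σ (IncEdges H₁ v₁) λ a → far H₁ v₁ a ≡ z × ι₂ (partner a) ∈ X

    blocked? : Decidable Blocked
    blocked? z = preimage₁? V X z
           ⊎-dec IncEdges-any? {H₁} {v₁} (λ a → (far H₁ v₁ a ≟ z) ×-dec (ι₂ (partner a) ∈? X))

    witness : ∀ {z} → Blocked z → Fin (n G)
    witness {z} (inj₁ _)       = ι₁ z
    witness     (inj₂ (a , _)) = ι₂ (partner a)

    -- Injective because H₂ has no parallel edges.
    witness-injective : ∀ {z z′} (p : Blocked z) (q : Blocked z′) → witness p ≡ witness q → z ≡ z′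
    witness-injective (inj₁ (z≢v₁ , _)) (inj₁ (z′≢v₁ , _)) eq = ι₁-injective z≢v₁ z′≢v₁ eq
    witness-injective (inj₁ (z≢v₁ , _)) (inj₂ (b , _))     eq = ⊥-elim (ι₁≢ι₂ z≢v₁ (partner≢ b) eq)
    witness-injective (inj₂ (a , _))     (inj₁ (z′≢v₁ , _)) eq = ⊥-elim (ι₁≢ι₂ z′≢v₁ (partner≢ a) (sym eq))
    witness-injective (inj₂ (a , refl , _)) (inj₂ (b , refl , _)) eq =
      cong (far H₁ v₁) (Injection.injective (↔⇒↣ ψ)
        (far-injective H₂ (KConnected⇒NoParallel k>2 K₂) _ _ (ι₂-injective (partner≢ a) (partner≢ b) eq)))

    B : Subset (n H₁)
    B = fromDec blocked?

    ∣B∣<k : ∣ B ∣ < k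
    ∣B∣<k = ℕ.≤-<-trans (∣fromDec∣≤ blocked? X witness
      (λ { (inj₁ (_ , ι₁z∈X)) → ι₁z∈X ; (inj₂ (_ , _ , p∈X)) → p∈X }) witness-injective) ∣X∣<k

    v₁∉B : v₁ ∉ B
    v₁∉B v₁∈B with ∈-fromDec⁻ blocked? v₁∈B
    ... | inj₁ (v₁≢v₁ , _)    = v₁≢v₁ refl
    ... | inj₂ (a , far≡v₁ , _) = far≢ H₁ noLoops₁ a far≡v₁

    ∣B∪v₁∣<n : ∣ B ∪ ⁅ v₁ ⁆ ∣ < n H₁
    ∣B∪v₁∣<n = begin-strict
      ∣ B ∪ ⁅ v₁ ⁆ ∣       ≤⟨ ∣p∪q∣≤∣p∣+∣q∣ B ⁅ v₁ ⁆ ⟩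
      ∣ B ∣ + ∣ ⁅ v₁ ⁆ ∣   ≡⟨ cong (∣ B ∣ +_) (∣⁅x⁆∣≡1 v₁) ⟩
      ∣ B ∣ + 1            ≡⟨ ℕ.+-comm ∣ B ∣ 1 ⟩
      suc ∣ B ∣            ≤⟨ ∣B∣<k ⟩
      k                    <⟨ KConnected⇒k<n k>2 K₁ ⟩
      n H₁                 ∎
      where open ℕ.≤-Reasoning

    unblocked-bridge : Bridge V X
    unblocked-bridge with ∣p∣<n⇒∃∉p (B ∪ ⁅ v₁ ⁆) ∣B∪v₁∣<n
    ... | y , y∉B∪v₁ =
      let (y∉B , y≢v₁) = ∉p∪⁅x⁆ y∉B∪v₁
          (a , far∉B)  = leave (KConnected⇒ConnectedWithout K₁ B ∣B∣<k v₁ y v₁∉B y∉B) y≢v₁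
      in bridge V X a (λ ι₁u∈X → far∉B (∈-fromDec⁺ blocked? (inj₁ (far≢ H₁ noLoops₁ a , ι₁u∈X))))
                      (λ ι₂p∈X → far∉B (∈-fromDec⁺ blocked? (inj₂ (a , refl , ι₂p∈X))))

connected : ∀ {G H₁ v₁ H₂ v₂} (V : SumView G H₁ v₁ H₂ v₂) {k} → 2 ≤ k →
  KConnected k H₁ → KConnected k H₂ → ∀ X → ∣ X ∣ < k → ConnectedWithout G X
connected V {k} 2≤k K₁ K₂ X ∣X∣<k with any? (preimage₁? (flip V) X) | any? (preimage₁? V X)
... | no side₂∉X | _ =
  connected-avoiding-side₂ V 2≤k K₁ K₂ X ∣X∣<k (λ y≢v₂ ι₂y∈X → side₂∉X (_ , y≢v₂ , ι₂y∈X))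
... | yes _ | no side₁∉X =
  connected-avoiding-side₂ (flip V) 2≤k K₂ K₁ X ∣X∣<k (λ x≢v₁ ι₁x∈X → side₁∉X (_ , x≢v₁ , ι₁x∈X))
... | yes (_ , w₂≢v₂ , ι₂w₂∈X) | yes (_ , w₁≢v₁ , ι₁w₁∈X) =
  connected-via-bridges V X
    (walk₁-meeting-side₂ V K₁ X ∣X∣<k w₂≢v₂ ι₂w₂∈X)
    (walk₁-meeting-side₂ (flip V) K₂ X ∣X∣<k w₁≢v₁ ι₁w₁∈X)
    (λ _ _ → unblocked-bridge V k>2 K₁ K₂ X ∣X∣<k)
  where
  k>2 : k > 2
  k>2 = ℕ.≤-<-trans (2≤∣p∣ ι₁w₁∈X ι₂w₂∈X (SumView.ι₁≢ι₂ V w₁≢v₁ w₂≢v₂)) ∣X∣<k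

mainTheorem10 : (k : ℕ) → 2 ≤ k →
    (H₁ : Graph) (v₁ : Fin (n H₁)) (H₂ : Graph) (v₂ : Fin (n H₂))
    (ψ : IncEdges H₁ v₁ ↔ IncEdges H₂ v₂) (G : Graph) →
    IsVertexSum G H₁ v₁ H₂ v₂ ψ →
    KConnected k H₁ → KConnected k H₂ → KConnected k G
mainTheorem10 k 2≤k H₁ v₁ H₂ v₂ ψ G sum K₁ K₂ = kConnected K₁ K₂
  where
  open VertexSum sum
  noLoops₁ : NoLoops H₁
  noLoops₁ = KConnected⇒NoLoops K₁
  noLoops₂ : NoLoops H₂
  noLoops₂ = KConnected⇒NoLoops K₂
  x₀ : ∃ λ x → x ≢ v₁
  x₀ = ∃≢ (KConnected⇒2≤n 2≤k K₁) v₁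
  y₀ : ∃ λ y → y ≢ v₂
  y₀ = ∃≢ (KConnected⇒2≤n 2≤k K₂) v₂
  V : SumView G H₁ v₁ H₂ v₂
  V = view (someVertex (proj₂ y₀)) noLoops₁ noLoops₂

  large : k < n G → KConnected k G
  large k<n = inj₁ (k<n , connected V 2≤k K₁ K₂ , noLoops noLoops₁ noLoops₂ ,
    λ k>2 → noParallel (KConnected⇒NoParallel k>2 K₁) (KConnected⇒NoParallel k>2 K₂))

  kConnected : KConnected k H₁ → KConnected k H₂ → KConnected k G
  kConnected (inj₁ (k<n₁ , _)) _ = large (ℕ.<-≤-trans k<n₁ (n₁≤n V (proj₂ y₀)))
  kConnected (inj₂ _) (inj₁ (k<n₂ , _)) = large (ℕ.<-≤-trans k<n₂ (n₁≤n (flip V) (proj₂ x₀)))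
  kConnected (inj₂ (k≡2 , n₁≡2 , _ , _ , _ , par)) (inj₂ (_ , n₂≡2 , _)) =
    inj₂ (k≡2 , ℕ.≤-antisym (n≤2 V n₁≡2 n₂≡2) (subst (_≤ n G) n₁≡2 (n₁≤n V (proj₂ y₀))) ,
          noLoops noLoops₁ noLoops₂ , parallel-cross n₁≡2 n₂≡2 noLoops₁ noLoops₂ par)
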